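{- Up to isomorphism there are exactly four double Boolean algebras with two elements, namely $\underline{D}_{2,I}$, $\underline{D}_{2,II}$, $\underline{D}_{2,III}$ and $\underline{2}$.
   Context: A double Boolean algebra (dBa) is an algebra $\underline{D}=(D;\sqcap,\sqcup,\neg,\lrcorner,\bot,\top)$ of type $(2,2,1,1,0,0)$ satisfying, for all $x,y,z$, where $x\vee y:=\neg(\neg x\sqcap\neg y)$ and $x\wedge y:=\lrcorner(\lrcorner x\sqcup\lrcorner y)$: $(x\sqcap x)\sqcap y=x\sqcap y$; $(x\sqcup x)\sqcup y=x\sqcup y$; $\sqcap$ and $\sqcup$ are commutative and associative; $x\sqcap(x\sqcup y)=x\sqcap x$; $x\sqcup(x\sqcap y)=x\sqcup x$; $x\sqcap(x\vee y)=x\sqcap x$; $x\sqcup(x\wedge y)=x\sqcup x$; $x\sqcap(y\vee z)=(x\sqcap y)\vee(x\sqcap z)$; $x\sqcup(y\wedge z)=(x\sqcup y)\wedge(x\sqcup z)$; $\neg\neg(x\sqcap y)=x\sqcap y$; $\lrcorner\lrcorner(x\sqcup y)=x\sqcup y$; $\neg(x\sqcap x)=\neg x$; $\lrcorner(x\sqcup x)=\lrcorner x$; $x\sqcap\neg x=\bot$; $x\sqcup\lrcorner x=\top$; $\neg\bot=\top\sqcap\top$; $\lrcorner\top=\bot\sqcup\bot$; $\neg\top=\bot$; $\lrcorner\bot=\top$; $(x\sqcap x)\sqcup(x\sqcap x)=(x\sqcup x)\sqcap(x\sqcup x)$. The algebras: $\underline{D}_{2,I}$ on $\{\bot,\top\}$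 with $\sqcap$ the Boolean meet, $x\sqcup y=\top$ for all $x,y$, $\neg\bot=\top,\neg\top=\bot$, $\lrcorner x=\top$ for all $x$; $\underline{D}_{2,II}$ on $\{\bot,\top\}$ with $x\sqcap y=\bot$ for all $x,y$, $\sqcup$ the Boolean join, $\neg x=\bot$ for all $x$, $\lrcorner\bot=\top,\lrcorner\top=\bot$; $\underline{D}_{2,III}$ on $\{\bot,a\}$ with $\top=\bot$ and all of $\sqcap,\sqcup,\neg,\lrcorner$ constantly $\bot$; $\underline{2}$ the two-element Boolean algebra with $\sqcap=\wedge$, $\sqcup=\vee$, $\neg=\lrcorner$ the complement. -}

module Defs where

open import Level using (Level) renaming (_⊔_ to _⊔ℓ_)
open import Data.Bool using (Bool; true; false; _∧_; _∨_; not)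
open import Data.Product using (_×_; Σ; Σ-syntax)
open import Relation.Binary.PropositionalEquality using (_≡_)
open import Function.Definitions using (Bijective)

record DAlg (ℓ : Level) : Set (Level.suc ℓ) where
  field
    Carrier : Set ℓ
    _⊓_ _⊔_ : Carrier → Carrier → Carrier
    ¬_ ⌟_   : Carrier → Carrier
    bot top : Carrier
  infixr 7 _⊓_
  infixr 6 _⊔_
  _∨′_ : Carrier → Carrier → Carrier
  x ∨′ y = ¬ ((¬ x) ⊓ (¬ y))
  _∧′_ : Carrier → Carrier → Carrier
  x ∧′ y = ⌟ ((⌟ x) ⊔ (⌟ y))

record IsDBA {ℓ : Level} (D : DAlg ℓ) : Set ℓ where
  open DAlg D
  field
    ax1a  : ∀ x y → (x ⊓ x) ⊓ y ≡ x ⊓ y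
    ax1b  : ∀ x y → (x ⊔ x) ⊔ y ≡ x ⊔ y
    ax2a  : ∀ x y → x ⊓ y ≡ y ⊓ x
    ax2b  : ∀ x y → x ⊔ y ≡ y ⊔ x
    ax3a  : ∀ x y z → x ⊓ (y ⊓ z) ≡ (x ⊓ y) ⊓ z
    ax3b  : ∀ x y z → x ⊔ (y ⊔ z) ≡ (x ⊔ y) ⊔ z
    ax4a  : ∀ x y → x ⊓ (x ⊔ y) ≡ x ⊓ x
    ax4b  : ∀ x y → x ⊔ (x ⊓ y) ≡ x ⊔ x
    ax5a  : ∀ x y → x ⊓ (x ∨′ y) ≡ x ⊓ x
    ax5b  : ∀ x y → x ⊔ (x ∧′ y) ≡ x ⊔ x
    ax6a  : ∀ x y z → x ⊓ (y ∨′ z) ≡ (x ⊓ y) ∨′ (x ⊓ z)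
    ax6b  : ∀ x y z → x ⊔ (y ∧′ z) ≡ (x ⊔ y) ∧′ (x ⊔ z)
    ax7a  : ∀ x y → ¬ (¬ (x ⊓ y)) ≡ x ⊓ y
    ax7b  : ∀ x y → ⌟ (⌟ (x ⊔ y)) ≡ x ⊔ y
    ax8a  : ∀ x → ¬ (x ⊓ x) ≡ ¬ x
    ax8b  : ∀ x → ⌟ (x ⊔ x) ≡ ⌟ x
    ax9a  : ∀ x → x ⊓ (¬ x) ≡ bot
    ax9b  : ∀ x → x ⊔ (⌟ x) ≡ top
    ax10a : ¬ bot ≡ top ⊓ top
    ax10b : ⌟ top ≡ bot ⊔ bot
    ax11a : ¬ top ≡ bot
    ax11b : ⌟ bot ≡ top
    ax12  : ∀ x → (x ⊓ x) ⊔ (x ⊓ x) ≡ (x ⊔ x) ⊓ (x ⊔ x)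

record _≅_ {a b : Level} (A : DAlg a) (B : DAlg b) : Set (a ⊔ℓ b) where
  module A = DAlg A
  module B = DAlg B
  field
    f       : A.Carrier → B.Carrier
    bij     : Bijective _≡_ _≡_ f
    pres-⊓  : ∀ x y → f (x A.⊓ y) ≡ f x B.⊓ f y
    pres-⊔  : ∀ x y → f (x A.⊔ y) ≡ f x B.⊔ f y
    pres-¬  : ∀ x → f (A.¬ x) ≡ B.¬ (f x)
    pres-⌟  : ∀ x → f (A.⌟ x) ≡ B.⌟ (f x)
    pres-bot : f A.bot ≡ B.bot
    pres-top : f A.top ≡ B.top

-- The four two-element algebras, all on Bool.
-- For D2I, D2II, 2: false = ⊥, true = ⊤.
-- For D2III: false = ⊥ (= ⊤), true = a.
D2I : DAlg Level.zero
D2I = record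
  { Carrier = Bool ; _⊓_ = _∧_ ; _⊔_ = λ _ _ → true
  ; ¬_ = not ; ⌟_ = λ _ → true ; bot = false ; top = true }

D2II : DAlg Level.zero
D2II = record
  { Carrier = Bool ; _⊓_ = λ _ _ → false ; _⊔_ = _∨_
  ; ¬_ = λ _ → false ; ⌟_ = not ; bot = false ; top = true }

D2III : DAlg Level.zero
D2III = record
  { Carrier = Bool ; _⊓_ = λ _ _ → false ; _⊔_ = λ _ _ → false
  ; ¬_ = λ _ → false ; ⌟_ = λ _ → false ; bot = false ; top = false }

Two : DAlg Level.zero
Two = record
  { Carrier = Bool ; _⊓_ = _∧_ ; _⊔_ = _∨_
  ; ¬_ = not ; ⌟_ = not ; bot = false ; top = true }

{-# OPTIONS --safe #-}
-- If ⊥ ≠ ⊤, the carrier is {⊥, ⊤}. The axioms already fix ⊤ ⊓ ⊥ = ⊥ ⊓ ⊥ = ⊥, ¬ ⊤ = ⊥ and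
-- ¬ ⊥ = ⊤ ⊓ ⊤, so the ⊓-half of the structure is determined by the single value ⊤ ⊓ ⊤: it is ⊤
-- (Boolean meet and complement) or ⊥ (everything constantly ⊥); dually the ⊔-half is determined
-- by ⊥ ⊔ ⊥. The axiom (x ⊓ x) ⊔ (x ⊓ x) = (x ⊔ x) ⊓ (x ⊔ x) at ⊤ rules out that both halves are
-- constant, and the remaining three combinations are D₂,I, D₂,II and 2. If ⊥ = ⊤, then ¬ ⊥ = ⊥,
-- and ¬ x = x would force x = ¬ (x ⊓ ¬ x) = ¬ ⊥ = ⊥; so ¬ is constantly ⊥, hence so is every
-- x ⊓ y = ¬ ¬ (x ⊓ y), and dually for ⊔ and ⌟: this is D₂,III. The four algebras are separated
-- by the equations ⊥ = ⊤, ⊤ ⊓ ⊤ = ⊥ and ⊥ ⊔ ⊥ = ⊤ between constants.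
module Submission where

open import Defs
import Level
open import Data.Bool using (Bool; true; false; _∧_; _∨_; not; if_then_else_)
open import Data.Bool.Properties using (∧-comm; ∨-comm; not-involutive)
open import Data.Empty using (⊥-elim)
open import Data.Fin using (Fin; zero; suc; opposite)
import Data.Fin.Properties as Fin
open import Data.Product using (_×_; ∃; _,_; proj₁; proj₂)
open import Data.Sum using (_⊎_; inj₁; inj₂)
open import Function using (_∘_)
open import Function.Bundles using (_↔_; Inverse; Injection; Bijection; mk⤖)
open import Function.Definitions using (Bijective)
open import Function.Properties.Bijection using (⤖⇒↔)
open import Function.Properties.Inverse using (↔-sym; ↔⇒⤖; Inverse⇒Injection)
open import Relation.Binary.Definitions using (DecidableEquality)
open import Relation.Binary.PropositionalEquality
open import Relation.Nullary.Decidable using (yes; no; via-injection)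

≅-sym : ∀ {a b} {A : DAlg a} {B : DAlg b} → A ≅ B → B ≅ A
≅-sym {A = A} {B} i = record
  { f        = from
  ; bij      = Bijection.bijective (↔⇒⤖ (↔-sym f↔))
  ; pres-⊓   = from-hom₂ {A._⊓_} {B._⊓_} pres-⊓
  ; pres-⊔   = from-hom₂ {A._⊔_} {B._⊔_} pres-⊔
  ; pres-¬   = from-hom₁ {A.¬_} {B.¬_} pres-¬
  ; pres-⌟   = from-hom₁ {A.⌟_} {B.⌟_} pres-⌟
  ; pres-bot = from-hom₀ pres-bot
  ; pres-top = from-hom₀ pres-top
  }
  where
  open _≅_ i
  f↔ : A.Carrier ↔ B.Carrier
  f↔ = ⤖⇒↔ (mk⤖ bij)
  open Inverse f↔ using (from; strictlyInverseˡ; strictlyInverseʳ)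
  open ≡-Reasoning

  from-hom₀ : ∀ {c d} → f c ≡ d → from d ≡ c
  from-hom₀ {c} refl = strictlyInverseʳ c

  from-hom₁ : ∀ {g h} → (∀ x → f (g x) ≡ h (f x)) → ∀ y → from (h y) ≡ g (from y)
  from-hom₁ {g} {h} hom y = begin
    from (h y)              ≡⟨ cong (from ∘ h) (strictlyInverseˡ y) ⟨
    from (h (f (from y)))   ≡⟨ from-hom₀ (hom (from y)) ⟩
    g (from y)              ∎

  from-hom₂ : ∀ {g h} → (∀ x y → f (g x y) ≡ h (f x) (f y)) →
              ∀ x y → from (h x y) ≡ g (from x) (from y)
  from-hom₂ {g} {h} hom x y = begin
    from (h x y)                        ≡⟨ cong₂ (λ u v → from (h u v)) (strictlyInverseˡ x) (strictlyInverseˡ y) ⟨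
    from (h (f (from x)) (f (from y)))  ≡⟨ from-hom₀ (hom (from x) (from y)) ⟩
    g (from x) (from y)                 ∎

module _ {a b} {A : DAlg a} {B : DAlg b} (i : A ≅ B) where
  open _≅_ i

  ≅-preserves-bot≡top : A.bot ≡ A.top → B.bot ≡ B.top
  ≅-preserves-bot≡top p = trans (sym pres-bot) (trans (cong f p) pres-top)

  ≅-preserves-top⊓top≡bot : A.top A.⊓ A.top ≡ A.bot → B.top B.⊓ B.top ≡ B.bot
  ≅-preserves-top⊓top≡bot p =
    trans (sym (trans (pres-⊓ A.top A.top) (cong₂ B._⊓_ pres-top pres-top)))
          (trans (cong f p) pres-bot)

  ≅-preserves-bot⊔bot≡top : A.bot A.⊔ A.bot ≡ A.top → B.bot B.⊔ B.bot ≡ B.top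
  ≅-preserves-bot⊔bot≡top p =
    trans (sym (trans (pres-⊔ A.bot A.bot) (cong₂ B._⊔_ pres-bot pres-bot)))
          (trans (cong f p) pres-top)

module TwoElementSet {A : Set} (e : A ↔ Fin 2) where
  open Inverse e using (to; from; strictlyInverseˡ)

  to-injective : ∀ {x y} → to x ≡ to y → x ≡ y
  to-injective = Injection.injective (Inverse⇒Injection e)

  infix 4 _≟_
  _≟_ : DecidableEquality A
  _≟_ = via-injection (Inverse⇒Injection e) Fin._≟_

  private
    third-is-second : {i j k : Fin 2} → i ≢ j → k ≢ i → k ≡ j
    third-is-second {_}        {zero}     {zero}     _   _   = refl
    third-is-second {_}        {suc zero} {suc zero} _   _   = refl
    third-is-second {zero}     {zero}     {suc zero} i≢j _   = ⊥-elim (i≢j refl)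
    third-is-second {suc zero} {suc zero} {zero}     i≢j _   = ⊥-elim (i≢j refl)
    third-is-second {zero}     {suc zero} {zero}     _   k≢i = ⊥-elim (k≢i refl)
    third-is-second {suc zero} {zero}     {suc zero} _   k≢i = ⊥-elim (k≢i refl)

    opposite-≢ : (i : Fin 2) → opposite i ≢ i
    opposite-≢ zero       ()
    opposite-≢ (suc zero) ()

  ≢-≢⇒≡ : ∀ {u v w} → u ≢ v → w ≢ u → w ≡ v
  ≢-≢⇒≡ u≢v w≢u = to-injective (third-is-second (u≢v ∘ to-injective) (w≢u ∘ to-injective))

  ≡⊎≡ : ∀ {u v} → u ≢ v → ∀ w → w ≡ u ⊎ w ≡ v
  ≡⊎≡ {u} u≢v w with w ≟ u
  ... | yes w≡u = inj₁ w≡u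
  ... | no  w≢u = inj₂ (≢-≢⇒≡ u≢v w≢u)

  ∃≢ : ∀ u → ∃ λ v → v ≢ u
  ∃≢ u = from (opposite (to u)) , λ p → opposite-≢ (to u) (trans (sym (strictlyInverseˡ _)) (cong to p))

  if-bijective : ∀ {u v} → u ≢ v → Bijective _≡_ _≡_ (λ b → if b then v else u)
  if-bijective {u} {v} u≢v = injective , surjective
    where
    injective : ∀ {b c} → (if b then v else u) ≡ (if c then v else u) → b ≡ c
    injective {false} {false} _ = refl
    injective {true}  {true}  _ = refl
    injective {false} {true}  p = ⊥-elim (u≢v p)
    injective {true}  {false} p = ⊥-elim (u≢v (sym p))

    surjective : ∀ w → ∃ λ b → ∀ {c} → c ≡ b → (if c then v else u) ≡ w
    surjective w with ≡⊎≡ u≢v w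
    ... | inj₁ w≡u = false , λ { refl → sym w≡u }
    ... | inj₂ w≡v = true  , λ { refl → sym w≡v }

module DBAProperties {ℓ} {D : DAlg ℓ} (isD : IsDBA D) where
  open DAlg D
  open IsDBA isD
  open ≡-Reasoning

  ⊓-idem-on-meets : ∀ x y → (x ⊓ y) ⊓ (x ⊓ y) ≡ x ⊓ y
  ⊓-idem-on-meets x y = begin
    (x ⊓ y) ⊓ (x ⊓ y)  ≡⟨ ax3a x y (x ⊓ y) ⟨
    x ⊓ y ⊓ x ⊓ y      ≡⟨ cong (x ⊓_) (ax3a y x y) ⟩
    x ⊓ (y ⊓ x) ⊓ y    ≡⟨ cong (λ z → x ⊓ z ⊓ y) (ax2a y x) ⟩
    x ⊓ (x ⊓ y) ⊓ y    ≡⟨ cong (x ⊓_) (ax3a x y y) ⟨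
    x ⊓ x ⊓ y ⊓ y      ≡⟨ ax3a x x (y ⊓ y) ⟩
    (x ⊓ x) ⊓ y ⊓ y    ≡⟨ ax1a x (y ⊓ y) ⟩
    x ⊓ y ⊓ y          ≡⟨ ax2a x (y ⊓ y) ⟩
    (y ⊓ y) ⊓ x        ≡⟨ ax1a y x ⟩
    y ⊓ x              ≡⟨ ax2a y x ⟩
    x ⊓ y              ∎

  ⊔-idem-on-joins : ∀ x y → (x ⊔ y) ⊔ (x ⊔ y) ≡ x ⊔ y
  ⊔-idem-on-joins x y = begin
    (x ⊔ y) ⊔ (x ⊔ y)  ≡⟨ ax3b x y (x ⊔ y) ⟨
    x ⊔ y ⊔ x ⊔ y      ≡⟨ cong (x ⊔_) (ax3b y x y) ⟩
    x ⊔ (y ⊔ x) ⊔ y    ≡⟨ cong (λ z → x ⊔ z ⊔ y) (ax2b y x) ⟩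
    x ⊔ (x ⊔ y) ⊔ y    ≡⟨ cong (x ⊔_) (ax3b x y y) ⟨
    x ⊔ x ⊔ y ⊔ y      ≡⟨ ax3b x x (y ⊔ y) ⟩
    (x ⊔ x) ⊔ y ⊔ y    ≡⟨ ax1b x (y ⊔ y) ⟩
    x ⊔ y ⊔ y          ≡⟨ ax2b x (y ⊔ y) ⟩
    (y ⊔ y) ⊔ x        ≡⟨ ax1b y x ⟩
    y ⊔ x              ≡⟨ ax2b y x ⟩
    x ⊔ y              ∎

  bot⊓bot≡bot : bot ⊓ bot ≡ bot
  bot⊓bot≡bot = subst (λ b → b ⊓ b ≡ b) (ax9a top) (⊓-idem-on-meets top (¬ top))

  top⊔top≡top : top ⊔ top ≡ top
  top⊔top≡top = subst (λ t → t ⊔ t ≡ t) (ax9b bot) (⊔-idem-on-joins bot (⌟ bot))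

  top⊓bot≡bot : top ⊓ bot ≡ bot
  top⊓bot≡bot = subst (λ b → top ⊓ b ≡ bot) ax11a (ax9a top)

  bot⊔top≡top : bot ⊔ top ≡ top
  bot⊔top≡top = subst (λ t → bot ⊔ t ≡ top) ax11b (ax9b bot)

  ¬-fixed⇒≡¬bot : ∀ {x} → ¬ x ≡ x → x ≡ ¬ bot
  ¬-fixed⇒≡¬bot {x} ¬x≡x = begin
    x            ≡⟨ ¬x≡x ⟨
    ¬ x          ≡⟨ ax8a x ⟨
    ¬ (x ⊓ x)    ≡⟨ cong (λ y → ¬ (x ⊓ y)) ¬x≡x ⟨
    ¬ (x ⊓ ¬ x)  ≡⟨ cong ¬_ (ax9a x) ⟩
    ¬ bot        ∎

  ⌟-fixed⇒≡⌟top : ∀ {x} → ⌟ x ≡ x → x ≡ ⌟ top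
  ⌟-fixed⇒≡⌟top {x} ⌟x≡x = begin
    x            ≡⟨ ⌟x≡x ⟨
    ⌟ x          ≡⟨ ax8b x ⟨
    ⌟ (x ⊔ x)    ≡⟨ cong (λ y → ⌟ (x ⊔ y)) ⌟x≡x ⟨
    ⌟ (x ⊔ ⌟ x)  ≡⟨ cong ⌟_ (ax9b x) ⟩
    ⌟ top        ∎

  top⊓top≡bot⇒bot⊔bot≡bot : top ⊓ top ≡ bot → bot ⊔ bot ≡ bot
  top⊓top≡bot⇒bot⊔bot≡bot p = begin
    bot ⊔ bot                      ≡⟨ cong₂ _⊔_ p p ⟨
    (top ⊓ top) ⊔ (top ⊓ top)      ≡⟨ ax12 top ⟩
    (top ⊔ top) ⊓ (top ⊔ top)      ≡⟨ cong₂ _⊓_ top⊔top≡top top⊔top≡top ⟩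
    top ⊓ top                      ≡⟨ p ⟩
    bot                            ∎

module Classification (D : DAlg Level.zero) (isD : IsDBA D) (e : DAlg.Carrier D ↔ Fin 2) where
  open DAlg D
  open IsDBA isD
  open DBAProperties isD
  open TwoElementSet e

  module Nondegenerate (bot≢top : bot ≢ top) where
    φ : Bool → Carrier
    φ b = if b then top else bot

    φ-bijective : Bijective _≡_ _≡_ φ
    φ-bijective = if-bijective bot≢top

    ⊓-is-∧ : top ⊓ top ≡ top → ∀ x y → φ (x ∧ y) ≡ φ x ⊓ φ y
    ⊓-is-∧ _ false false = sym bot⊓bot≡bot
    ⊓-is-∧ _ false true  = sym (trans (ax2a bot top) top⊓bot≡bot)
    ⊓-is-∧ _ true  false = sym top⊓bot≡bot
    ⊓-is-∧ p true  true  = sym p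

    ¬-is-not : top ⊓ top ≡ top → ∀ x → φ (not x) ≡ ¬ φ x
    ¬-is-not p false = sym (trans ax10a p)
    ¬-is-not _ true  = sym ax11a

    ⊓-is-const : top ⊓ top ≡ bot → ∀ x y → bot ≡ φ x ⊓ φ y
    ⊓-is-const _ false false = sym bot⊓bot≡bot
    ⊓-is-const _ false true  = sym (trans (ax2a bot top) top⊓bot≡bot)
    ⊓-is-const _ true  false = sym top⊓bot≡bot
    ⊓-is-const p true  true  = sym p

    ¬-is-const : top ⊓ top ≡ bot → ∀ x → bot ≡ ¬ φ x
    ¬-is-const p false = sym (trans ax10a p)
    ¬-is-const _ true  = sym ax11a

    ⊔-is-∨ : bot ⊔ bot ≡ bot → ∀ x y → φ (x ∨ y) ≡ φ x ⊔ φ y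
    ⊔-is-∨ p false false = sym p
    ⊔-is-∨ _ false true  = sym bot⊔top≡top
    ⊔-is-∨ _ true  false = sym (trans (ax2b top bot) bot⊔top≡top)
    ⊔-is-∨ _ true  true  = sym top⊔top≡top

    ⌟-is-not : bot ⊔ bot ≡ bot → ∀ x → φ (not x) ≡ ⌟ φ x
    ⌟-is-not _ false = sym ax11b
    ⌟-is-not p true  = sym (trans ax10b p)

    ⊔-is-const : bot ⊔ bot ≡ top → ∀ x y → top ≡ φ x ⊔ φ y
    ⊔-is-const p false false = sym p
    ⊔-is-const _ false true  = sym bot⊔top≡top
    ⊔-is-const _ true  false = sym (trans (ax2b top bot) bot⊔top≡top)
    ⊔-is-const _ true  true  = sym top⊔top≡top

    ⌟-is-const : bot ⊔ bot ≡ top → ∀ x → top ≡ ⌟ φ x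
    ⌟-is-const _ false = sym ax11b
    ⌟-is-const p true  = sym (trans ax10b p)

    D2I≅D : top ⊓ top ≡ top → bot ⊔ bot ≡ top → D2I ≅ D
    D2I≅D p q = record
      { f = φ ; bij = φ-bijective
      ; pres-⊓ = ⊓-is-∧ p ; pres-¬ = ¬-is-not p
      ; pres-⊔ = ⊔-is-const q ; pres-⌟ = ⌟-is-const q
      ; pres-bot = refl ; pres-top = refl
      }

    D2II≅D : top ⊓ top ≡ bot → D2II ≅ D
    D2II≅D p = record
      { f = φ ; bij = φ-bijective
      ; pres-⊓ = ⊓-is-const p ; pres-¬ = ¬-is-const p
      ; pres-⊔ = ⊔-is-∨ q ; pres-⌟ = ⌟-is-not q
      ; pres-bot = refl ; pres-top = refl
      }
      where
      q : bot ⊔ bot ≡ bot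
      q = top⊓top≡bot⇒bot⊔bot≡bot p

    Two≅D : top ⊓ top ≡ top → bot ⊔ bot ≡ bot → Two ≅ D
    Two≅D p q = record
      { f = φ ; bij = φ-bijective
      ; pres-⊓ = ⊓-is-∧ p ; pres-¬ = ¬-is-not p
      ; pres-⊔ = ⊔-is-∨ q ; pres-⌟ = ⌟-is-not q
      ; pres-bot = refl ; pres-top = refl
      }

    classification : (D ≅ D2I) ⊎ (D ≅ D2II) ⊎ (D ≅ D2III) ⊎ (D ≅ Two)
    classification with top ⊓ top ≟ top | bot ⊔ bot ≟ bot
    ... | no  p | _     = inj₂ (inj₁ (≅-sym (D2II≅D (≢-≢⇒≡ (bot≢top ∘ sym) p))))
    ... | yes p | no  q = inj₁ (≅-sym (D2I≅D p (≢-≢⇒≡ bot≢top q)))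
    ... | yes p | yes q = inj₂ (inj₂ (inj₂ (≅-sym (Two≅D p q))))

  module Degenerate (bot≡top : bot ≡ top) where
    a : Carrier
    a = proj₁ (∃≢ bot)

    bot≢a : bot ≢ a
    bot≢a = proj₂ (∃≢ bot) ∘ sym

    ¬bot≡bot : ¬ bot ≡ bot
    ¬bot≡bot = subst (λ t → ¬ t ≡ bot) (sym bot≡top) ax11a

    ⌟top≡bot : ⌟ top ≡ bot
    ⌟top≡bot = trans (cong ⌟_ (sym bot≡top)) (trans ax11b (sym bot≡top))

    ¬≡bot : ∀ x → ¬ x ≡ bot
    ¬≡bot x with ≡⊎≡ bot≢a x | ≡⊎≡ bot≢a (¬ x)
    ... | _          | inj₁ ¬x≡bot = ¬x≡bot
    ... | inj₁ refl  | inj₂ _      = ¬bot≡bot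
    ... | inj₂ refl  | inj₂ ¬a≡a   = ⊥-elim (bot≢a (sym (trans (¬-fixed⇒≡¬bot ¬a≡a) ¬bot≡bot)))

    ⌟≡bot : ∀ x → ⌟ x ≡ bot
    ⌟≡bot x with ≡⊎≡ bot≢a x | ≡⊎≡ bot≢a (⌟ x)
    ... | _          | inj₁ ⌟x≡bot = ⌟x≡bot
    ... | inj₁ refl  | inj₂ _      = trans (cong ⌟_ bot≡top) ⌟top≡bot
    ... | inj₂ refl  | inj₂ ⌟a≡a   = ⊥-elim (bot≢a (sym (trans (⌟-fixed⇒≡⌟top ⌟a≡a) ⌟top≡bot)))

    ⊓≡bot : ∀ x y → x ⊓ y ≡ bot
    ⊓≡bot x y = trans (sym (ax7a x y)) (¬≡bot _)

    ⊔≡bot : ∀ x y → x ⊔ y ≡ bot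
    ⊔≡bot x y = trans (sym (ax7b x y)) (⌟≡bot _)

    D2III≅D : D2III ≅ D
    D2III≅D = record
      { f = λ b → if b then a else bot ; bij = if-bijective bot≢a
      ; pres-⊓ = λ x y → sym (⊓≡bot _ _)
      ; pres-⊔ = λ x y → sym (⊔≡bot _ _)
      ; pres-¬ = λ x → sym (¬≡bot _)
      ; pres-⌟ = λ x → sym (⌟≡bot _)
      ; pres-bot = refl ; pres-top = bot≡top
      }

  classification : (D ≅ D2I) ⊎ (D ≅ D2II) ⊎ (D ≅ D2III) ⊎ (D ≅ Two)
  classification with bot ≟ top
  ... | yes bot≡top = inj₂ (inj₂ (inj₁ (≅-sym (Degenerate.D2III≅D bot≡top))))
  ... | no  bot≢top = Nondegenerate.classification bot≢top

isDBA-D2I : IsDBA D2I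
isDBA-D2I = record
  { ax1a  = λ { false _ → refl ; true _ → refl }
  ; ax1b  = λ _ _ → refl
  ; ax2a  = ∧-comm
  ; ax2b  = λ _ _ → refl
  ; ax3a  = λ { false _ _ → refl ; true _ _ → refl }
  ; ax3b  = λ _ _ _ → refl
  ; ax4a  = λ { false _ → refl ; true _ → refl }
  ; ax4b  = λ _ _ → refl
  ; ax5a  = λ { false _ → refl ; true _ → refl }
  ; ax5b  = λ _ _ → refl
  ; ax6a  = λ { false _ _ → refl ; true _ _ → refl }
  ; ax6b  = λ _ _ _ → refl
  ; ax7a  = λ x y → not-involutive (x ∧ y)
  ; ax7b  = λ _ _ → refl
  ; ax8a  = λ { false → refl ; true → refl }
  ; ax8b  = λ _ → refl
  ; ax9a  = λ { false → refl ; true → refl }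
  ; ax9b  = λ _ → refl
  ; ax10a = refl
  ; ax10b = refl
  ; ax11a = refl
  ; ax11b = refl
  ; ax12  = λ _ → refl
  }

isDBA-D2II : IsDBA D2II
isDBA-D2II = record
  { ax1a  = λ _ _ → refl
  ; ax1b  = λ { false _ → refl ; true _ → refl }
  ; ax2a  = λ _ _ → refl
  ; ax2b  = ∨-comm
  ; ax3a  = λ _ _ _ → refl
  ; ax3b  = λ { false _ _ → refl ; true _ _ → refl }
  ; ax4a  = λ _ _ → refl
  ; ax4b  = λ { false _ → refl ; true _ → refl }
  ; ax5a  = λ _ _ → refl
  ; ax5b  = λ { false _ → refl ; true _ → refl }
  ; ax6a  = λ _ _ _ → refl
  ; ax6b  = λ { false _ _ → refl ; true _ _ → refl }
  ; ax7a  = λ _ _ → refl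
  ; ax7b  = λ x y → not-involutive (x ∨ y)
  ; ax8a  = λ _ → refl
  ; ax8b  = λ { false → refl ; true → refl }
  ; ax9a  = λ _ → refl
  ; ax9b  = λ { false → refl ; true → refl }
  ; ax10a = refl
  ; ax10b = refl
  ; ax11a = refl
  ; ax11b = refl
  ; ax12  = λ _ → refl
  }

isDBA-D2III : IsDBA D2III
isDBA-D2III = record
  { ax1a  = λ _ _ → refl
  ; ax1b  = λ _ _ → refl
  ; ax2a  = λ _ _ → refl
  ; ax2b  = λ _ _ → refl
  ; ax3a  = λ _ _ _ → refl
  ; ax3b  = λ _ _ _ → refl
  ; ax4a  = λ _ _ → refl
  ; ax4b  = λ _ _ → refl
  ; ax5a  = λ _ _ → refl
  ; ax5b  = λ _ _ → refl
  ; ax6a  = λ _ _ _ → refl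
  ; ax6b  = λ _ _ _ → refl
  ; ax7a  = λ _ _ → refl
  ; ax7b  = λ _ _ → refl
  ; ax8a  = λ _ → refl
  ; ax8b  = λ _ → refl
  ; ax9a  = λ _ → refl
  ; ax9b  = λ _ → refl
  ; ax10a = refl
  ; ax10b = refl
  ; ax11a = refl
  ; ax11b = refl
  ; ax12  = λ _ → refl
  }

isDBA-Two : IsDBA Two
isDBA-Two = record
  { ax1a  = λ { false _ → refl ; true _ → refl }
  ; ax1b  = λ { false _ → refl ; true _ → refl }
  ; ax2a  = ∧-comm
  ; ax2b  = ∨-comm
  ; ax3a  = λ { false _ _ → refl ; true _ _ → refl }
  ; ax3b  = λ { false _ _ → refl ; true _ _ → refl }
  ; ax4a  = λ { false _ → refl ; true _ → refl }
  ; ax4b  = λ { false _ → refl ; true _ → refl }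
  ; ax5a  = λ { false _ → refl ; true _ → refl }
  ; ax5b  = λ { false _ → refl ; true _ → refl }
  ; ax6a  = λ { false _ _ → refl ; true _ _ → refl }
  ; ax6b  = λ { false _ _ → refl ; true _ _ → refl }
  ; ax7a  = λ x y → not-involutive (x ∧ y)
  ; ax7b  = λ x y → not-involutive (x ∨ y)
  ; ax8a  = λ { false → refl ; true → refl }
  ; ax8b  = λ { false → refl ; true → refl }
  ; ax9a  = λ { false → refl ; true → refl }
  ; ax9b  = λ { false → refl ; true → refl }
  ; ax10a = refl
  ; ax10b = refl
  ; ax11a = refl
  ; ax11b = refl
  ; ax12  = λ { false → refl ; true → refl }
  }

-- Imported late: inside the modules above, ¬_ is the negation of the double Boolean algebra.
open import Relation.Nullary using (¬_)

D2I≇D2II : ¬ (D2I ≅ D2II)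
D2I≇D2II i with ≅-preserves-bot⊔bot≡top i refl
... | ()

D2I≇D2III : ¬ (D2I ≅ D2III)
D2I≇D2III i with ≅-preserves-bot≡top (≅-sym i) refl
... | ()

D2I≇Two : ¬ (D2I ≅ Two)
D2I≇Two i with ≅-preserves-bot⊔bot≡top i refl
... | ()

D2II≇D2III : ¬ (D2II ≅ D2III)
D2II≇D2III i with ≅-preserves-bot≡top (≅-sym i) refl
... | ()

D2II≇Two : ¬ (D2II ≅ Two)
D2II≇Two i with ≅-preserves-top⊓top≡bot i refl
... | ()

D2III≇Two : ¬ (D2III ≅ Two)
D2III≇Two i with ≅-preserves-bot≡top i refl
... | ()

proposition4p1 :
    (IsDBA D2I × IsDBA D2II × IsDBA D2III × IsDBA Two)
    × (¬ (D2I ≅ D2II) × ¬ (D2I ≅ D2III) × ¬ (D2I ≅ Two)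
       × ¬ (D2II ≅ D2III) × ¬ (D2II ≅ Two) × ¬ (D2III ≅ Two))
    × (∀ (D : DAlg Level.zero) → IsDBA D → (DAlg.Carrier D ↔ Fin 2)
        → (D ≅ D2I) ⊎ (D ≅ D2II) ⊎ (D ≅ D2III) ⊎ (D ≅ Two))
proposition4p1 =
    (isDBA-D2I , isDBA-D2II , isDBA-D2III , isDBA-Two)
  , (D2I≇D2II , D2I≇D2III , D2I≇Two , D2II≇D2III , D2II≇Two , D2III≇Two)
  , Classification.classification
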